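{- Let $n>0$ and $m>1$ be integers with $n\equiv r\pmod m$, $1\le r<m$. If $C=(c_1,\dots,c_k)\in SP(n,m)$, then $c_1\equiv r\pmod m$ or $c_k\equiv r\pmod m$.
   Context: Fix $m>1$. Semi-$m$-Pell compositions: $SP(n,m)=\{(n)\}$ for $1\le n\le m$; if $n>m$ and $m\mid n$, $SP(n,m)$ consists of the compositions in $SP(n/m,m)$ with every part multiplied by $m$; if $n>m$ and $n\equiv r\pmod m$, $1\le r\le m-1$, $SP(n,m)$ consists of the compositions obtained by inserting a part $r$ at the beginning or end of each composition in $SP(n-r,m)$, together with those obtained from each composition in $SP(n-m,m)$ by adding $m$ to its (unique) part congruent to $r$ mod $m$. -}

module Defs where

open import Data.Nat using (ℕ; zero; suc; _+_; _*_; _∸_; _≤_; _<_; NonZero)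
open import Data.Nat.DivMod using (_%_; _/_)
open import Data.Nat.Divisibility using (_∣_)
open import Data.List using (List; []; _∷_; [_]; _++_; map; _∷ʳ_)
open import Data.List.Relation.Unary.All using (All)
open import Relation.Binary.PropositionalEquality using (_≡_; _≢_)

infix 4 _≡_[mod_]
_≡_[mod_] : ℕ → ℕ → (m : ℕ) → .{{NonZero m}} → Set
a ≡ b [mod m ] = a % m ≡ b % m

data AddM (m r : ℕ) .{{_ : NonZero m}} : List ℕ → List ℕ → Set where
  addM : (xs ys : List ℕ) (x : ℕ) →
         x % m ≡ r →
         All (λ y → y % m ≢ r) xs →
         All (λ y → y % m ≢ r) ys →
         AddM m r (xs ++ x ∷ ys) (xs ++ (x + m) ∷ ys)

-- SP m n C : the composition C belongs to SP(n,m) (semi-m-Pell compositions).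
data SP (m : ℕ) .{{_ : NonZero m}} : ℕ → List ℕ → Set where
  sp-base  : ∀ {n} → 1 ≤ n → n ≤ m → SP m n [ n ]
  sp-scale : ∀ {n C} → m < n → m ∣ n → SP m (n / m) C →
             SP m n (map (m *_) C)
  sp-left  : ∀ {n C} → m < n → n % m ≢ 0 →
             SP m (n ∸ n % m) C → SP m n (n % m ∷ C)
  sp-right : ∀ {n C} → m < n → n % m ≢ 0 →
             SP m (n ∸ n % m) C → SP m n (C ∷ʳ n % m)
  sp-add   : ∀ {n C C'} → m < n → n % m ≢ 0 →
             SP m (n ∸ m) C → AddM m (n % m) C C' → SP m n C'

-- A composition of n with n ≢ 0 (mod m) arises from the left, right or add-m
-- rule, never from scaling.  The first two put a part ≡ n (mod m) at an end.
-- For the add-m rule, n − m ≡ n (mod m), so by induction the old composition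
-- has an end part ≡ n (mod m); since the part receiving m is the only such
-- part, it sits at that end, and adding m keeps its residue.
module Submission where

open import Defs
open import Data.Nat using (ℕ; _≤_; _<_; NonZero; _+_; _∸_; _%_)
open import Data.Nat.Properties using (<⇒≤; n>0⇒n≢0)
open import Data.Nat.DivMod using (m%n%n≡m%n; [m+n]%n≡m%n; m≤n⇒[n∸m]%m≡n%m; m*n%n≡0; m<n⇒m%n≡m)
open import Data.Nat.Divisibility using (divides)
open import Data.List using (List; []; _∷_; _∷ʳ_; _++_; [_]; initLast; _∷ʳ′_)
open import Data.List.Properties using (∷-injective; ∷ʳ-injective; ++-assoc)
open import Data.List.Relation.Unary.All using (All; _∷_)
open import Data.List.Relation.Unary.All.Properties using (∷ʳ⁻)
open import Data.Product using (Σ; _×_; _,_; proj₂)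
open import Data.Sum using (_⊎_; inj₁; inj₂)
open import Relation.Nullary using (¬_; contradiction)
open import Relation.Binary.PropositionalEquality using (_≡_; _≢_; refl; sym; trans)

EndPart : (ℕ → Set) → List ℕ → Set
EndPart P C = Σ ℕ (λ c → Σ (List ℕ) (λ rest →
  ((C ≡ c ∷ rest) × P c) ⊎ ((C ≡ rest ∷ʳ c) × P c)))

EndPart-mono : ∀ {P Q : ℕ → Set} → (∀ {c} → P c → Q c) → ∀ {C} → EndPart P C → EndPart Q C
EndPart-mono P⇒Q (c , rest , inj₁ (eq , pc)) = c , rest , inj₁ (eq , P⇒Q pc)
EndPart-mono P⇒Q (c , rest , inj₂ (eq , pc)) = c , rest , inj₂ (eq , P⇒Q pc)

EndPart-++-∷ : ∀ {P : ℕ → Set} xs y ys → xs ≡ [] ⊎ ys ≡ [] → P y → EndPart P (xs ++ y ∷ ys)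
EndPart-++-∷ .[] y ys (inj₁ refl) py = y , ys , inj₁ (refl , py)
EndPart-++-∷ xs y .[] (inj₂ refl) py = y , xs , inj₂ (refl , py)

unique-part-at-end : ∀ {P : ℕ → Set} xs x ys → All (λ y → ¬ P y) xs → All (λ y → ¬ P y) ys →
                     EndPart P (xs ++ x ∷ ys) → xs ≡ [] ⊎ ys ≡ []
unique-part-at-end [] x ys _ _ (_ , _ , inj₁ _) = inj₁ refl
unique-part-at-end (a ∷ xs) x ys (¬pa ∷ _) _ (c , rest , inj₁ (eq , pc))
  with refl , _ ← ∷-injective eq = contradiction pc ¬pa
unique-part-at-end xs x ys _ ¬ys (c , rest , inj₂ (eq , pc)) with initLast ys
... | [] = inj₂ refl
... | ys′ ∷ʳ′ b
  with _ , refl ← ∷ʳ-injective (xs ++ x ∷ ys′) rest (trans (++-assoc xs (x ∷ ys′) [ b ]) eq)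
  = contradiction pc (proj₂ (∷ʳ⁻ ¬ys))

module _ (m : ℕ) .{{_ : NonZero m}} where

  sp-endPart : ∀ {n C} → SP m n C → n % m ≢ 0 → EndPart (_≡ n [mod m ]) C
  sp-endPart {n} (sp-base _ _) _ = n , [] , inj₁ (refl , refl)
  sp-endPart (sp-scale _ (divides q refl) _) n≢0 = contradiction (m*n%n≡0 q m) n≢0
  sp-endPart {n} (sp-left {C = C} _ _ _) _ = n % m , C , inj₁ (refl , m%n%n≡m%n n m)
  sp-endPart {n} (sp-right {C = C} _ _ _) _ = n % m , C , inj₂ (refl , m%n%n≡m%n n m)
  sp-endPart {n} (sp-add m<n _ sp (addM xs ys x x≡n ¬xs ¬ys)) n≢0 =
    EndPart-++-∷ xs (x + m) ys (unique-part-at-end xs x ys ¬xs ¬ys endPart)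
                 (trans ([m+n]%n≡m%n x m) x≡n)
    where
    [n∸m]≡n : (n ∸ m) % m ≡ n % m
    [n∸m]≡n = m≤n⇒[n∸m]%m≡n%m (<⇒≤ m<n)

    endPart : EndPart (_≡ n [mod m ]) (xs ++ x ∷ ys)
    endPart = EndPart-mono (λ p → trans p [n∸m]≡n)
                           (sp-endPart sp (λ e → n≢0 (trans (sym [n∸m]≡n) e)))

lemma3p1 : (m n r : ℕ) .{{_ : NonZero m}} → 1 < m → 0 < n →
    (n ≡ r [mod m ]) → 1 ≤ r → r < m →
    (C : List ℕ) → SP m n C →
    Σ ℕ (λ c → Σ (List ℕ) (λ rest →
    ((C ≡ c ∷ rest) × (c ≡ r [mod m ])) ⊎ ((C ≡ rest ∷ʳ c) × (c ≡ r [mod m ]))))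
lemma3p1 m n r _ _ n≡r 1≤r r<m C sp =
  EndPart-mono (λ p → trans p n≡r) (sp-endPart m sp n%m≢0)
  where
  n%m≡r : n % m ≡ r
  n%m≡r = trans n≡r (m<n⇒m%n≡m r<m)

  n%m≢0 : n % m ≢ 0
  n%m≢0 e = n>0⇒n≢0 1≤r (trans (sym n%m≡r) e)
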